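{- Let $G$ be a near-bipartite brick and $\{e_1,e_2\}$ a pair of edges of $G$ such that $H=G-\{e_1,e_2\}$ is a bipartite matching covered graph, and let $(U,W)$ be the bipartition of $H$ such that $e_1$ joins two vertices of $U$ and $e_2$ joins two vertices of $W$. Let $S$ be a subset of $U$ containing at most one end of $e_1$, or a subset of $W$ containing at most one end of $e_2$. If $S'\subseteq V(G)$ satisfies $N_G(S)\subseteq S'$ and $|S'|\ge 2$, then $|S'|\ge |S|+2$.
   Context: Graphs are finite and may have multiple edges but no loops. $N_G(S)$ is the set of vertices of $G$ not in $S$ having a neighbour in $S$. A connected graph with at least two vertices is matching covered if every edge lies in some perfect matching. A brick is a 3-connected nonbipartite graph $G$ such that $G-x-y$ has a perfect matching for any two distinct vertices $x,y$ (equivalently, a nonbipartite matching covered graph with no nontrivial tight cuts). A nonbipartite matching covered graph is near-bipartite if removing some pair of its edges yields a bipartite matching covered graph. -}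

module Defs where

open import Data.Nat using (ℕ; _≤_; _<_)
open import Data.Fin using (Fin)
open import Data.Fin.Subset using (Subset; _∈_; _∉_; ⊤; ∁; ∣_∣; _─_)
open import Data.Product using (Σ; _×_; ∃)
open import Data.Sum using (_⊎_)
open import Relation.Nullary using (¬_)
open import Relation.Binary.PropositionalEquality using (_≡_; _≢_)

record Multigraph (n m : ℕ) : Set where
  field
    endA endB : Fin m → Fin n
    noLoop    : ∀ e → endA e ≢ endB e
open Multigraph public

module _ {n m : ℕ} (G : Multigraph n m) where

  Inc : Fin m → Fin n → Set
  Inc e v = (endA G e ≡ v) ⊎ (endB G e ≡ v)

  -- Subgraphs of G: a vertex set X together with a set F of edges of G;
  -- an edge of the subgraph is an edge in F with both ends in X.
  -- (Deleting vertices / edges is expressed by choosing X and F.)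
  Usable : Subset n → (Fin m → Set) → Fin m → Set
  Usable X F e = F e × endA G e ∈ X × endB G e ∈ X

  AllEdges : Fin m → Set
  AllEdges _ = Data.Unit.⊤
    where import Data.Unit

  data Reach (X : Subset n) (F : Fin m → Set) : Fin n → Fin n → Set where
    here : ∀ {u} → Reach X F u u
    stepAB : ∀ {u w} e → Usable X F e → endA G e ≡ u → Reach X F (endB G e) w → Reach X F u w
    stepBA : ∀ {u w} e → Usable X F e → endB G e ≡ u → Reach X F (endA G e) w → Reach X F u w

  Connected : Subset n → (Fin m → Set) → Set
  Connected X F = ∀ u v → u ∈ X → v ∈ X → Reach X F u v

  PerfectMatching : Subset n → (Fin m → Set) → Subset m → Set
  PerfectMatching X F M =
    (∀ e → e ∈ M → Usable X F e) ×
    (∀ v → v ∈ X → Σ (Fin m) λ e → e ∈ M × Inc e v × (∀ e′ → e′ ∈ M → Inc e′ v → e′ ≡ e))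

  MatchingCovered : Subset n → (Fin m → Set) → Set
  MatchingCovered X F =
    Connected X F × 2 ≤ ∣ X ∣ ×
    (∀ e → Usable X F e → Σ (Subset m) λ M → PerfectMatching X F M × e ∈ M)

  -- U is a bipartition class: every edge has exactly one end in U
  -- (the other class being X ∖ U)
  IsBipartition : Subset n → (Fin m → Set) → Subset n → Set
  IsBipartition X F U =
    ∀ e → Usable X F e → (endA G e ∈ U × endB G e ∉ U) ⊎ (endA G e ∉ U × endB G e ∈ U)

  Bipartite : Subset n → (Fin m → Set) → Set
  Bipartite X F = Σ (Subset n) λ U → IsBipartition X F U

  Without : Fin m → Fin m → Fin m → Set
  Without e₁ e₂ e = e ≢ e₁ × e ≢ e₂

  KConnected : ℕ → Set
  KConnected k = k < n × (∀ (Y : Subset n) → ∣ Y ∣ < k → Connected (∁ Y) AllEdges)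

  IsBrick : Set
  IsBrick =
    KConnected 3 × ¬ Bipartite ⊤ AllEdges ×
    (∀ x y → x ≢ y → Σ (Subset m) λ M → PerfectMatching (⊤ ─ Data.Fin.Subset.⁅ x ⁆ ─ Data.Fin.Subset.⁅ y ⁆) AllEdges M)

  IsNearBipartite : Set
  IsNearBipartite =
    MatchingCovered ⊤ AllEdges × ¬ Bipartite ⊤ AllEdges ×
    Σ (Fin m) λ e₁ → Σ (Fin m) λ e₂ → e₁ ≢ e₂ ×
      Bipartite ⊤ (Without e₁ e₂) × MatchingCovered ⊤ (Without e₁ e₂)

  InNbhd : Subset n → Fin n → Set
  InNbhd S v = v ∉ S × Σ (Fin m) λ e →
    (endA G e ≡ v × endB G e ∈ S) ⊎ (endB G e ≡ v × endA G e ∈ S)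

  AtMostOneEnd : Fin m → Subset n → Set
  AtMostOneEnd e S = ¬ (endA G e ∈ S × endB G e ∈ S)

-- S is independent: apart from e₁ and e₂ every edge of G joins U to its complement, and the
-- hypothesis rules out e₁ and e₂. If S ≠ ∅, the set S′ ∖ S contains every neighbour of a vertex
-- of S, so 3-connectivity gives two vertices x ≠ y in it. A perfect matching of G - x - y then
-- sends S injectively into N(S) ∖ {x, y} ⊆ S′ ∖ {x, y}.
module Submission where

open import Defs
open import Data.Nat using (ℕ; _≤_; _+_; _<_; z≤n; s≤s; _≤?_)
open import Data.Nat.Properties using (≤-trans; ≰⇒>; +-comm; +-monoˡ-≤; m+n≤o⇒m≤o∸n)
open import Data.Fin using (Fin; zero; suc) renaming (_≟_ to _≟ᶠ_)
open import Data.Fin.Properties using (suc-injective; 0≢1+n)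
open import Data.Fin.Subset using (Subset; _∈_; _∉_; _⊆_; ⊤; ∁; ∣_∣; _─_; _-_; inside; outside; Nonempty)
open import Data.Fin.Subset.Properties
  using (∈⊤; nonempty?; Empty-unique; ∣⊥∣≡0; ∣∁p∣≡n∸∣p∣; x∈∁p⇒x∉p; x∉p⇒x∈∁p; x∈p⇒x∉∁p;
         x∈p∧x∉q⇒x∈p─q; x∈p∧x≢y⇒x∈p-y; p─q⊆p; x∈p⇒∣p-x∣<∣p∣)
open import Data.Vec using ([]; _∷_; here; there)
open import Data.Product using (_×_; ∃; _,_; proj₁; proj₂; swap)
open import Data.Sum using (_⊎_; inj₁; inj₂)
open import Data.Empty using (⊥-elim)
open import Relation.Nullary using (yes; no)
open import Relation.Binary.PropositionalEquality using (_≡_; _≢_; refl; sym; trans; subst)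

x∈p─q⇒x∉q : ∀ {n} {p q : Subset n} {x : Fin n} → x ∈ p ─ q → x ∉ q
x∈p─q⇒x∉q {p = _ ∷ _} {inside  ∷ _} ()            here
x∈p─q⇒x∉q {p = _ ∷ _} {outside ∷ _} here          ()
x∈p─q⇒x∉q {p = _ ∷ _} {_       ∷ _} (there x∈p─q) (there x∈q) = x∈p─q⇒x∉q x∈p─q x∈q

x∈p─r∧x∈q⇒x∈q─r : ∀ {n} {p q r : Subset n} {x : Fin n} → x ∈ p ─ r → x ∈ q → x ∈ q ─ r
x∈p─r∧x∈q⇒x∈q─r x∈p─r x∈q = x∈p∧x∉q⇒x∈p─q x∈q (x∈p─q⇒x∉q x∈p─r)

nonempty : ∀ {n} (p : Subset n) → 1 ≤ ∣ p ∣ → Nonempty p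
nonempty (inside  ∷ p) _ = zero , here
nonempty (outside ∷ p) 1≤∣p∣ with x , x∈p ← nonempty p 1≤∣p∣ = suc x , there x∈p

two-distinct : ∀ {n} (p : Subset n) → 2 ≤ ∣ p ∣ → ∃ λ x → ∃ λ y → x ∈ p × y ∈ p × x ≢ y
two-distinct (inside ∷ p) (s≤s 1≤∣p∣) with y , y∈p ← nonempty p 1≤∣p∣ =
  zero , suc y , here , there y∈p , λ ()
two-distinct (outside ∷ p) 2≤∣p∣ with x , y , x∈p , y∈p , x≢y ← two-distinct p 2≤∣p∣ =
  suc x , suc y , there x∈p , there y∈p , λ sx≡sy → x≢y (suc-injective sx≡sy)

∣p-x-y∣+2≤∣p∣ : ∀ {n} {p : Subset n} {x y : Fin n} → x ∈ p → y ∈ p → x ≢ y → ∣ p - x - y ∣ + 2 ≤ ∣ p ∣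
∣p-x-y∣+2≤∣p∣ {p = p} {x} {y} x∈p y∈p x≢y =
  subst (_≤ ∣ p ∣) (+-comm 2 ∣ p - x - y ∣)
    (≤-trans (s≤s (x∈p⇒∣p-x∣<∣p∣ (x∈p∧x≢y⇒x∈p-y y∈p λ y≡x → x≢y (sym y≡x)))) (x∈p⇒∣p-x∣<∣p∣ x∈p))

∣p∣≤∣q∣-by-injection : ∀ {n k} {R : Fin n → Fin k → Set} (p : Subset n) {q : Subset k} →
  (∀ {x} → x ∈ p → ∃ λ y → y ∈ q × R x y) →
  (∀ {x x′ y} → R x y → R x′ y → x ≡ x′) →
  ∣ p ∣ ≤ ∣ q ∣
∣p∣≤∣q∣-by-injection [] _ _ = z≤n
∣p∣≤∣q∣-by-injection {R = R} (inside ∷ p) {q} img inj with y₀ , y₀∈q , R0y₀ ← img here =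
  ≤-trans (s≤s (∣p∣≤∣q∣-by-injection p img′ (λ r r′ → suc-injective (inj r r′)))) (x∈p⇒∣p-x∣<∣p∣ y₀∈q)
  where
  img′ : ∀ {x} → x ∈ p → ∃ λ y → y ∈ q - y₀ × R (suc x) y
  img′ x∈p with y , y∈q , r ← img (there x∈p) =
    y , x∈p∧x≢y⇒x∈p-y y∈q (λ { refl → 0≢1+n (inj R0y₀ r) }) , r
∣p∣≤∣q∣-by-injection (outside ∷ p) img inj =
  ∣p∣≤∣q∣-by-injection p (λ x∈p → img (there x∈p)) (λ r r′ → suc-injective (inj r r′))

module _ {n m : ℕ} (G : Multigraph n m) where

  Joins : Fin m → Fin n → Fin n → Set
  Joins e s t = (endA G e ≡ s × endB G e ≡ t) ⊎ (endB G e ≡ s × endA G e ≡ t)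

  Independent : Subset n → Set
  Independent S = ∀ e → AtMostOneEnd G e S

  MatchedBy : Subset m → Fin n → Fin n → Set
  MatchedBy M s t = ∃ λ e → e ∈ M × Joins e s t

  Joins⇒Inc : ∀ {e s t} → Joins e s t → Inc G e t
  Joins⇒Inc (inj₁ (_ , b≡t)) = inj₂ b≡t
  Joins⇒Inc (inj₂ (_ , a≡t)) = inj₁ a≡t

  Joins-injective : ∀ {e s s′ t} → Joins e s t → Joins e s′ t → s ≡ s′
  Joins-injective (inj₁ (a≡s , _))   (inj₁ (a≡s′ , _)) = trans (sym a≡s) a≡s′
  Joins-injective {e} (inj₁ (_ , b≡t)) (inj₂ (_ , a≡t)) = ⊥-elim (noLoop G e (trans a≡t (sym b≡t)))
  Joins-injective {e} (inj₂ (_ , a≡t)) (inj₁ (_ , b≡t)) = ⊥-elim (noLoop G e (trans a≡t (sym b≡t)))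
  Joins-injective (inj₂ (b≡s , _))   (inj₂ (b≡s′ , _)) = trans (sym b≡s) b≡s′

  Usable⇒Inc∈ : ∀ {X F e v} → Usable G X F e → Inc G e v → v ∈ X
  Usable⇒Inc∈ (_ , a∈X , _) (inj₁ refl) = a∈X
  Usable⇒Inc∈ (_ , _ , b∈X) (inj₂ refl) = b∈X

  Reach⇒neighbour : ∀ {X F s w} → s ≢ w → Reach G X F s w → ∃ λ t → t ∈ X × ∃ λ e → Joins e s t
  Reach⇒neighbour s≢s here = ⊥-elim (s≢s refl)
  Reach⇒neighbour _ (stepAB e (_ , _ , b∈X) refl _) = endB G e , b∈X , e , inj₁ (refl , refl)
  Reach⇒neighbour _ (stepBA e (_ , a∈X , _) refl _) = endA G e , a∈X , e , inj₂ (refl , refl)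

  Connected⇒neighbour : ∀ {X F s} → Connected G X F → 2 ≤ ∣ X ∣ → s ∈ X →
    ∃ λ t → t ∈ X × ∃ λ e → Joins e s t
  Connected⇒neighbour {X} {s = s} conn 2≤∣X∣ s∈X
    with x , y , x∈X , y∈X , x≢y ← two-distinct X 2≤∣X∣ with s ≟ᶠ x
  ... | yes refl = Reach⇒neighbour x≢y (conn s y s∈X y∈X)
  ... | no s≢x   = Reach⇒neighbour s≢x (conn s x s∈X x∈X)

  KConnected⇒k≤∣T∣ : ∀ {k s} {T : Subset n} → KConnected G k → s ∉ T →
    (∀ {e t} → Joins e s t → t ∈ T) → k ≤ ∣ T ∣
  KConnected⇒k≤∣T∣ {k} {s} {T} (k<n , conn) s∉T nbrs∈T with k ≤? ∣ T ∣
  ... | yes k≤∣T∣ = k≤∣T∣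
  ... | no k≰∣T∣ =
    no-neighbour-outside-T (Connected⇒neighbour (conn T ∣T∣<k) 2≤∣∁T∣ (x∉p⇒x∈∁p s∉T))
    where
    no-neighbour-outside-T : (∃ λ t → t ∈ ∁ T × ∃ λ e → Joins e s t) → k ≤ ∣ T ∣
    no-neighbour-outside-T (t , t∈∁T , _ , s—t) = ⊥-elim (x∈∁p⇒x∉p t∈∁T (nbrs∈T s—t))
    ∣T∣<k : ∣ T ∣ < k
    ∣T∣<k = ≰⇒> k≰∣T∣
    2≤∣∁T∣ : 2 ≤ ∣ ∁ T ∣
    2≤∣∁T∣ = subst (2 ≤_) (sym (∣∁p∣≡n∸∣p∣ T)) (m+n≤o⇒m≤o∸n 2 (≤-trans (s≤s ∣T∣<k) k<n))

  IsBipartition-mono : ∀ {X F F′ U} → (∀ e → F′ e → F e) →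
    IsBipartition G X F U → IsBipartition G X F′ U
  IsBipartition-mono F′⊆F bip e (F′e , a∈X , b∈X) = bip e (F′⊆F e F′e , a∈X , b∈X)

  IsBipartition-∁ : ∀ {X F U} → IsBipartition G X F U → IsBipartition G X F (∁ U)
  IsBipartition-∁ bip e usable with bip e usable
  ... | inj₁ (a∈U , b∉U) = inj₂ (x∈p⇒x∉∁p a∈U , x∉p⇒x∈∁p b∉U)
  ... | inj₂ (a∉U , b∈U) = inj₁ (x∉p⇒x∈∁p a∉U , x∈p⇒x∉∁p b∈U)

  class⇒Independent : ∀ {e₁ e₂ U S} → IsBipartition G ⊤ (Without G e₁ e₂) U → S ⊆ U →
    AtMostOneEnd G e₁ S → endA G e₂ ∉ U → Independent S
  class⇒Independent {e₁} {e₂} bip S⊆U e₁-ok a₂∉U e (a∈S , b∈S) with e ≟ᶠ e₁ | e ≟ᶠ e₂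
  ... | yes refl | _        = e₁-ok (a∈S , b∈S)
  ... | no _     | yes refl = a₂∉U (S⊆U a∈S)
  ... | no e≢e₁  | no e≢e₂  with bip e ((e≢e₁ , e≢e₂) , ∈⊤ , ∈⊤)
  ...   | inj₁ (_ , b∉U) = b∉U (S⊆U b∈S)
  ...   | inj₂ (a∉U , _) = a∉U (S⊆U a∈S)

  Independent⇒InNbhd : ∀ {S e s t} → Independent S → s ∈ S → Joins e s t → InNbhd G S t
  Independent⇒InNbhd {e = e} indep s∈S (inj₁ (refl , refl)) =
    (λ t∈S → indep e (s∈S , t∈S)) , e , inj₂ (refl , s∈S)
  Independent⇒InNbhd {e = e} indep s∈S (inj₂ (refl , refl)) =
    (λ t∈S → indep e (t∈S , s∈S)) , e , inj₁ (refl , s∈S)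

  PerfectMatching⇒partner : ∀ {X F M s} → PerfectMatching G X F M → s ∈ X →
    ∃ λ t → t ∈ X × MatchedBy M s t
  PerfectMatching⇒partner (usable , cover) s∈X with cover _ s∈X
  ... | e , e∈M , inj₁ refl , _ = endB G e , proj₂ (proj₂ (usable e e∈M)) , e , e∈M , inj₁ (refl , refl)
  ... | e , e∈M , inj₂ refl , _ = endA G e , proj₁ (proj₂ (usable e e∈M)) , e , e∈M , inj₂ (refl , refl)

  PerfectMatching⇒MatchedBy-injective : ∀ {X F M s s′ t} → PerfectMatching G X F M →
    MatchedBy M s t → MatchedBy M s′ t → s ≡ s′
  PerfectMatching⇒MatchedBy-injective {F = F} (usable , cover) (e , e∈M , s—t) (e′ , e′∈M , s′—t)
    with _ , _ , _ , unique ← cover _ (Usable⇒Inc∈ {F = F} (usable e e∈M) (Joins⇒Inc s—t))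
    with refl ← trans (unique e e∈M (Joins⇒Inc s—t)) (sym (unique e′ e′∈M (Joins⇒Inc s′—t)))
    = Joins-injective s—t s′—t

  PerfectMatching⇒∣S∣+2≤∣S′∣ : ∀ {F M S S′ x y} → PerfectMatching G (⊤ - x - y) F M →
    x ≢ y → x ∈ S′ → y ∈ S′ → x ∉ S → y ∉ S →
    (∀ {s t} → s ∈ S → MatchedBy M s t → t ∈ S′) → ∣ S ∣ + 2 ≤ ∣ S′ ∣
  PerfectMatching⇒∣S∣+2≤∣S′∣ {S = S} {S′} {x} {y} pm x≢y x∈S′ y∈S′ x∉S y∉S partners∈S′ =
    ≤-trans (+-monoˡ-≤ 2 (∣p∣≤∣q∣-by-injection S partner (PerfectMatching⇒MatchedBy-injective pm)))
            (∣p-x-y∣+2≤∣p∣ x∈S′ y∈S′ x≢y)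
    where
    partner : ∀ {s} → s ∈ S → ∃ λ t → t ∈ S′ - x - y × MatchedBy _ s t
    partner s∈S
      with t , t∈⊤-x-y , s—t ← PerfectMatching⇒partner pm
             (x∈p∧x≢y⇒x∈p-y (x∈p∧x≢y⇒x∈p-y ∈⊤ λ { refl → x∉S s∈S }) λ { refl → y∉S s∈S })
      = t , x∈p─r∧x∈q⇒x∈q─r t∈⊤-x-y (x∈p─r∧x∈q⇒x∈q─r (p─q⊆p _ _ t∈⊤-x-y) (partners∈S′ s∈S s—t)) , s—t

  Independent⇒∣S∣+2≤∣S′∣ : ∀ {S S′} → IsBrick G → Independent S → (∀ v → InNbhd G S v → v ∈ S′) →
    Nonempty S → ∣ S ∣ + 2 ≤ ∣ S′ ∣
  Independent⇒∣S∣+2≤∣S′∣ {S} {S′} (3-connected , _ , matchable) indep N⊆S′ (s , s∈S) =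
    avoiding (two-distinct (S′ ─ S)
      (≤-trans (s≤s (s≤s z≤n))
        (KConnected⇒k≤∣T∣ 3-connected (λ s∈T → x∈p─q⇒x∉q s∈T s∈S) (neighbour∈S′─S s∈S))))
    where
    neighbour∈S′─S : ∀ {e s t} → s ∈ S → Joins e s t → t ∈ S′ ─ S
    neighbour∈S′─S s∈S s—t with t∈N ← Independent⇒InNbhd indep s∈S s—t =
      x∈p∧x∉q⇒x∈p─q (N⊆S′ _ t∈N) (proj₁ t∈N)

    avoiding : (∃ λ x → ∃ λ y → x ∈ S′ ─ S × y ∈ S′ ─ S × x ≢ y) → ∣ S ∣ + 2 ≤ ∣ S′ ∣
    avoiding (x , y , x∈T , y∈T , x≢y) =
      PerfectMatching⇒∣S∣+2≤∣S′∣ (proj₂ (matchable x y x≢y)) x≢y (p─q⊆p _ _ x∈T) (p─q⊆p _ _ y∈T)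
        (x∈p─q⇒x∉q x∈T) (x∈p─q⇒x∉q y∈T) (λ s∈S (_ , _ , s—t) → p─q⊆p _ _ (neighbour∈S′─S s∈S s—t))

lemma2p7 : ∀ {n m : ℕ} (G : Multigraph n m) → IsBrick G → IsNearBipartite G →
    (e₁ e₂ : Fin m) → e₁ ≢ e₂ →
    Bipartite G ⊤ (Without G e₁ e₂) → MatchingCovered G ⊤ (Without G e₁ e₂) →
    (U : Subset n) → IsBipartition G ⊤ (Without G e₁ e₂) U →
    endA G e₁ ∈ U → endB G e₁ ∈ U → endA G e₂ ∉ U → endB G e₂ ∉ U →
    (S : Subset n) →
    ((S ⊆ U × AtMostOneEnd G e₁ S) ⊎ (S ⊆ ∁ U × AtMostOneEnd G e₂ S)) →
    (S′ : Subset n) → (∀ v → InNbhd G S v → v ∈ S′) → 2 ≤ ∣ S′ ∣ →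
    ∣ S ∣ + 2 ≤ ∣ S′ ∣
lemma2p7 {n} G brick _ e₁ e₂ _ _ _ U bip a₁∈U _ a₂∉U _ S S-class S′ N⊆S′ 2≤∣S′∣ with nonempty? S
... | yes S-nonempty = Independent⇒∣S∣+2≤∣S′∣ G brick (S-independent S-class) N⊆S′ S-nonempty
  where
  S-independent : (S ⊆ U × AtMostOneEnd G e₁ S) ⊎ (S ⊆ ∁ U × AtMostOneEnd G e₂ S) → Independent G S
  S-independent (inj₁ (S⊆U , e₁-ok)) = class⇒Independent G bip S⊆U e₁-ok a₂∉U
  S-independent (inj₂ (S⊆∁U , e₂-ok)) =
    class⇒Independent G (IsBipartition-mono G (λ _ → swap) (IsBipartition-∁ G bip))
      S⊆∁U e₂-ok (x∈p⇒x∉∁p a₁∈U)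
... | no S-empty =
  subst (λ p → ∣ p ∣ + 2 ≤ ∣ S′ ∣) (sym (Empty-unique S-empty))
    (subst (λ k → k + 2 ≤ ∣ S′ ∣) (sym (∣⊥∣≡0 n)) 2≤∣S′∣)
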